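{- Let $G$ be a finite simple undirected graph and $n\ge1$. For every degenerate singular $n$-cube $\sigma$ on $G$, $\psi(\sigma)=0$. In particular, $\psi$ induces an $R$-linear map $\psi:\mathcal{C}^{\mathrm{Cube}}_n(G)\to\mathcal{C}^{\mathrm{Path}}_n(G)$.
   Context: $R$ is a commutative ring with unit. A graph homomorphism is a vertex map sending adjacent vertices to equal or adjacent vertices. $Q_n$ is the graph on $\{0,1\}^n$ with Hamming-distance-one edges; a singular $n$-cube on $G$ is a graph homomorphism $\sigma: Q_n\to G$. For $i\in[n]$: $f_i^{\pm}\sigma(a_1,\dots,a_{n-1})=\sigma(a_1,\dots,a_{i-1},\epsilon,a_i,\dots,a_{n-1})$ with $\epsilon=1$ for $+$, $0$ for $-$; $\sigma$ is degenerate if $f_i^+\sigma=f_i^-\sigma$ for some $i$. $\mathcal{C}^{\mathrm{Cube}}_n(G)$ is the free $R$-module on singular $n$-cubes modulo the submodule spanned by degenerate ones. Path complex: for $V=V(G)$, $\mathcal{C}_n(V)$ is the free $R$-module on $(n+1)$-tuples of vertices modulo the span of tuples with $v_i=v_{i+1}$ for some $i$; $\partial_n(v_0,\dots,v_n)=\sum_{i=0}^n(-1)^i(v_0,\dots,\widehat{v_i},\dots,v_n)$. $\widetilde{\mathcal{C}}_n(G)$ is the submodule generated by allowed paths (tuples with $\{v_i,v_{i+1}\}\in E(G)$ for all $i$); $\mathcal{C}^{\mathrm{Path}}_n(G)=\{x\in\widetilde{\mathcal{C}}_n(G):\partial_nx\in\widetilde{\mathcal{C}}_{n-1}(G)\}$.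 The map $\psi$: for $\tau\in S_n$, $p_\tau$ is the path $p_\tau(0),\dots,p_\tau(n)$ in $Q_n$ from $(0,\dots,0)$ whose $i$-th step flips coordinate $\tau(i)$ from $0$ to $1$. $\psi(\sigma)=\sum_{\tau\in S_n}\mathrm{sign}(\tau)\,(\sigma(p_\tau(0)),\dots,\sigma(p_\tau(n)))\in\mathcal{C}_n(V)$, extended linearly; it is known (and may be used) that $\psi(\sigma)\in\mathcal{C}^{\mathrm{Path}}_n(G)$ for every singular $n$-cube $\sigma$. -}

module Defs where

open import Level using (Level; _⊔_) renaming (suc to lsuc)
open import Data.Bool using (Bool; true; false; if_then_else_; _∧_; not)
open import Data.Nat using (ℕ; zero; suc) renaming (_+_ to _+ℕ_)
open import Data.Fin using (Fin; zero; suc; inject₁; _<?_; _≟_)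
open import Data.Vec using (Vec; []; _∷_; lookup; insertAt; _[_]≔_; replicate; count)
import Data.Vec.Properties as VecP
open import Data.List using (List; []; _∷_; map; concatMap; filter; foldr)
open import Data.List.Relation.Unary.All using (All)
open import Data.Product using (Σ; ∃; _×_; _,_; proj₁; proj₂)
open import Data.Sum using (_⊎_)
open import Relation.Nullary using (¬_; does)
open import Relation.Binary.PropositionalEquality using (_≡_; _≢_)
open import Algebra.Bundles using (CommutativeRing)

record Graph : Set₁ where
  field
    V     : ℕ
    Adj   : Fin V → Fin V → Set
    adj?  : ∀ x y → Relation.Nullary.Dec (Adj x y)
    sym   : ∀ {x y} → Adj x y → Adj y x
    irrefl : ∀ {x} → ¬ Adj x x

open Graph public

-- The hypercube graph Q_n on {0,1}^n (false = 0, true = 1).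

hamming : ∀ {n} → Vec Bool n → Vec Bool n → ℕ
hamming []       []       = 0
hamming (a ∷ as) (b ∷ bs) = (if does (Data.Bool._≟_ a b) then 0 else 1) +ℕ hamming as bs

QAdj : ∀ {n} → Vec Bool n → Vec Bool n → Set
QAdj a b = hamming a b ≡ 1

IsSingularCube : (G : Graph) (n : ℕ) → (Vec Bool n → Fin (V G)) → Set
IsSingularCube G n σ = ∀ a b → QAdj a b → σ a ≡ σ b ⊎ Adj G (σ a) (σ b)

face : ∀ {A : Set} {k} → Fin (suc k) → Bool → (Vec Bool (suc k) → A) → Vec Bool k → A
face i ε σ a = σ (insertAt a i ε)

IsDegenerateCube : ∀ {A : Set} {k} → (Vec Bool (suc k) → A) → Set
IsDegenerateCube {k = k} σ = ∃ λ (i : Fin (suc k)) → ∀ (a : Vec Bool k) → face i true σ a ≡ face i false σ a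

-- The symmetric group S_n, enumerated as the list of all injective
-- sequences τ = (τ(1),…,τ(n)) ∈ Fin n ^ n.

allVecs : ∀ {A : Set} → List A → (k : ℕ) → List (Vec A k)
allVecs xs zero    = [] ∷ []
allVecs xs (suc k) = concatMap (λ x → map (x ∷_) (allVecs xs k)) xs

allFinList : (n : ℕ) → List (Fin n)
allFinList n = Data.Vec.toList (Data.Vec.allFin n)

notIn : ∀ {n k} → Fin n → Vec (Fin n) k → Bool
notIn x []       = true
notIn x (y ∷ ys) = not (does (x ≟ y)) ∧ notIn x ys

distinct : ∀ {n k} → Vec (Fin n) k → Bool
distinct []       = true
distinct (x ∷ xs) = notIn x xs ∧ distinct xs

perms : (n : ℕ) → List (Vec (Fin n) n)
perms n = Data.List.filter (λ τ → Data.Bool._≟_ (distinct τ) true) (allVecs (allFinList n) n)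

inversions : ∀ {n k} → Vec (Fin n) k → ℕ
inversions []       = 0
inversions (x ∷ xs) = count (λ y → y <? x) xs +ℕ inversions xs

evenᵇ : ℕ → Bool
evenᵇ zero    = true
evenᵇ (suc k) = not (evenᵇ k)

pathFrom : ∀ {n k} → Vec Bool n → Vec (Fin n) k → Vec (Vec Bool n) (suc k)
pathFrom v []       = v ∷ []
pathFrom v (c ∷ cs) = v ∷ pathFrom (v [ c ]≔ true) cs

pathOf : ∀ {n} → Vec (Fin n) n → Vec (Vec Bool n) (suc n)
pathOf {n} τ = pathFrom (replicate n false) τ

module _ {c ℓ : Level} (R : CommutativeRing c ℓ) where
  open CommutativeRing R

  sign : ∀ {n} → Vec (Fin n) n → Carrier
  sign τ = if evenᵇ (inversions τ) then 1# else - 1#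

  -- An element of the free R-module on (n+1)-tuples of vertices of V,
  -- presented as a finite formal sum Σ r·t.
  Chain : (m n : ℕ) → Set c
  Chain m n = List (Carrier × Vec (Fin m) (suc n))

  coeff : ∀ {m n} → Chain m n → Vec (Fin m) (suc n) → Carrier
  coeff []             t = 0#
  coeff ((r , s) ∷ xs) t =
    (if does (VecP.≡-dec _≟_ s t) then r else 0#) + coeff xs t

  DegTuple : ∀ {m n} → Vec (Fin m) (suc n) → Set
  DegTuple {n = n} t = ∃ λ (i : Fin n) → lookup t (inject₁ i) ≡ lookup t (suc i)

  -- x is zero in C_n(V), i.e. x lies in the submodule spanned by degenerate tuples
  IsZeroInC : ∀ {m n} → Chain m n → Set (c ⊔ ℓ)
  IsZeroInC {m} {n} x =
    Σ (Chain m n) λ L → All (λ p → DegTuple (proj₂ p)) L × (∀ t → coeff x t ≈ coeff L t)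

  ψ : ∀ {m n} → (Vec Bool n → Fin m) → Chain m n
  ψ {n = n} σ = map (λ τ → sign τ , Data.Vec.map σ (pathOf τ)) (perms n)

  ψLin : ∀ {m n} → List (Carrier × (Vec Bool n → Fin m)) → Chain m n
  ψLin []             = []
  ψLin ((r , σ) ∷ xs) = map (λ p → r * proj₁ p , proj₂ p) (ψ σ) Data.List.++ ψLin xs

-- Let σ be degenerate in direction i, so σ does not see coordinate i. Every
-- permutation τ flips coordinate i at some step j, hence σ(p_τ(j-1)) = σ(p_τ(j)):
-- each single term of ψ(σ) is already a degenerate tuple, so ψ(σ) vanishes in
-- C_n(V) without any cancellation between terms, and without using that σ is a
-- graph homomorphism.

module Submission where

open import Defs hiding (sym)
open import Level using (Level)
open import Data.Bool using (Bool; true; false)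
open import Data.Bool.Properties using (∧-conicalˡ; ∧-conicalʳ)
open import Data.Nat using (ℕ; suc)
open import Data.Nat.Properties using (n<1+n)
open import Data.Fin using (Fin; zero; suc; inject₁; punchOut; _≟_)
open import Data.Fin.Properties using (pigeonhole; punchOut-injective; any?; <⇒≢)
open import Data.Vec using (Vec; []; _∷_; lookup; insertAt; removeAt; _[_]≔_)
import Data.Vec as Vec
open import Data.Vec.Properties using (lookup-map; insertAt-removeAt)
open import Data.List using (List; []; _∷_)
open import Data.List.Relation.Unary.All using (All; []; _∷_)
import Data.List.Relation.Unary.All as All
open import Data.List.Relation.Unary.All.Properties using (all-filter; map⁺; ++⁺)
open import Data.Product using (_×_; _,_; proj₂; ∃)
open import Function.Definitions using (Injective)
open import Relation.Nullary using (yes; no; contradiction)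
open import Relation.Binary.PropositionalEquality
  using (_≡_; _≢_; refl; sym; cong; module ≡-Reasoning)
open import Algebra.Bundles using (CommutativeRing)

insertAt-removeAt-[]≔ : ∀ {A : Set} {n} (w : Vec A (suc n)) (i : Fin (suc n)) (b : A) →
  insertAt (removeAt w i) i b ≡ w [ i ]≔ b
insertAt-removeAt-[]≔ (x ∷ xs)         zero    b = refl
insertAt-removeAt-[]≔ (x ∷ xs@(_ ∷ _)) (suc i) b = cong (x ∷_) (insertAt-removeAt-[]≔ xs i b)

degenerate⇒[]≔true-invariant : ∀ {A : Set} {k} (σ : Vec Bool (suc k) → A) (i : Fin (suc k)) →
  (∀ a → face i true σ a ≡ face i false σ a) → ∀ w → σ w ≡ σ (w [ i ]≔ true)
degenerate⇒[]≔true-invariant σ i f⁺≡f⁻ w = begin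
  σ w                                          ≡⟨ cong σ (sym (insertAt-removeAt w i)) ⟩
  σ (insertAt (removeAt w i) i (lookup w i))   ≡⟨ face-constant (lookup w i) ⟩
  σ (insertAt (removeAt w i) i true)           ≡⟨ cong σ (insertAt-removeAt-[]≔ w i true) ⟩
  σ (w [ i ]≔ true)                            ∎
  where
  open ≡-Reasoning
  face-constant : ∀ b → σ (insertAt (removeAt w i) i b) ≡ σ (insertAt (removeAt w i) i true)
  face-constant true  = refl
  face-constant false = sym (f⁺≡f⁻ (removeAt w i))

lookup-pathFrom-suc : ∀ {n k} (v : Vec Bool n) (cs : Vec (Fin n) k) (j : Fin k) →
  lookup (pathFrom v cs) (suc j) ≡ lookup (pathFrom v cs) (inject₁ j) [ lookup cs j ]≔ true
lookup-pathFrom-suc v (c ∷ [])     zero    = refl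
lookup-pathFrom-suc v (c ∷ _ ∷ _)  zero    = refl
lookup-pathFrom-suc v (c ∷ cs)     (suc j) = lookup-pathFrom-suc (v [ c ]≔ true) cs j

notIn⇒lookup≢ : ∀ {n k} (x : Fin n) (ys : Vec (Fin n) k) → notIn x ys ≡ true →
  ∀ j → lookup ys j ≢ x
notIn⇒lookup≢ x (y ∷ ys) x∉ j yⱼ≡x with x ≟ y
notIn⇒lookup≢ x (y ∷ ys) () j yⱼ≡x | yes _
notIn⇒lookup≢ x (y ∷ ys) x∉ zero    y≡x | no x≢y = x≢y (sym y≡x)
notIn⇒lookup≢ x (y ∷ ys) x∉ (suc j) yⱼ≡x | no _  = notIn⇒lookup≢ x ys x∉ j yⱼ≡x

distinct⇒lookup-injective : ∀ {n k} (τ : Vec (Fin n) k) → distinct τ ≡ true →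
  Injective _≡_ _≡_ (lookup τ)
distinct⇒lookup-injective (x ∷ τ) d {zero}  {zero}  _  = refl
distinct⇒lookup-injective (x ∷ τ) d {zero}  {suc j} eq =
  contradiction (sym eq) (notIn⇒lookup≢ x τ (∧-conicalˡ _ _ d) j)
distinct⇒lookup-injective (x ∷ τ) d {suc i} {zero}  eq =
  contradiction eq (notIn⇒lookup≢ x τ (∧-conicalˡ _ _ d) i)
distinct⇒lookup-injective (x ∷ τ) d {suc i} {suc j} eq =
  cong suc (distinct⇒lookup-injective τ (∧-conicalʳ _ _ d) eq)

-- If f missed i, then punchOut would inject Fin (suc n) into Fin n.
injective⇒surjective : ∀ {n} (f : Fin (suc n) → Fin (suc n)) → Injective _≡_ _≡_ f →
  ∀ i → ∃ λ j → f j ≡ i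
injective⇒surjective f f-inj i with any? (λ j → f j ≟ i)
... | yes hit = hit
... | no miss with pigeonhole (n<1+n _) (λ j → punchOut {j = f j} (λ i≡fj → miss (j , sym i≡fj)))
...   | a , b , a<b , eq =
  contradiction (f-inj (punchOut-injective (λ e → miss (a , sym e)) (λ e → miss (b , sym e)) eq))
                (<⇒≢ a<b)

perms-distinct : ∀ n → All (λ τ → distinct τ ≡ true) (perms n)
perms-distinct n = all-filter (λ τ → Data.Bool._≟_ (distinct τ) true) (allVecs (allFinList n) n)

module _ {c ℓ : Level} (R : CommutativeRing c ℓ) where
  open CommutativeRing R using (Carrier) renaming (refl to ≈-refl)

  Degenerate-terms : ∀ {m n} → Chain R m n → Set c
  Degenerate-terms = All (λ p → DegTuple R (proj₂ p))

  degenerate-terms⇒zero : ∀ {m n} (x : Chain R m n) → Degenerate-terms x → IsZeroInC R x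
  degenerate-terms⇒zero x deg = x , deg , λ _ → ≈-refl

  pathFrom-degenerate : ∀ {m n k} (σ : Vec Bool n → Fin m) (i : Fin n) →
    (∀ w → σ w ≡ σ (w [ i ]≔ true)) →
    ∀ v (cs : Vec (Fin n) k) j → lookup cs j ≡ i → DegTuple R (Vec.map σ (pathFrom v cs))
  pathFrom-degenerate σ .(lookup cs j) invariant v cs j refl = j , (begin
    lookup (Vec.map σ path) (inject₁ j)                ≡⟨ lookup-map (inject₁ j) σ path ⟩
    σ (lookup path (inject₁ j))                        ≡⟨ invariant _ ⟩
    σ (lookup path (inject₁ j) [ lookup cs j ]≔ true)  ≡⟨ cong σ (sym (lookup-pathFrom-suc v cs j)) ⟩
    σ (lookup path (suc j))                            ≡⟨ sym (lookup-map (suc j) σ path) ⟩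
    lookup (Vec.map σ path) (suc j)                    ∎)
    where
    open ≡-Reasoning
    path = pathFrom v cs

  ψ-degenerate-terms : ∀ {m k} (σ : Vec Bool (suc k) → Fin m) → IsDegenerateCube σ →
    Degenerate-terms (ψ R σ)
  ψ-degenerate-terms {k = k} σ (i , f⁺≡f⁻) =
    map⁺ (All.map (λ {τ} → term-degenerate τ) (perms-distinct (suc k)))
    where
    term-degenerate : ∀ τ → distinct τ ≡ true → DegTuple R (Vec.map σ (pathOf τ))
    term-degenerate τ d =
      let j , τⱼ≡i = injective⇒surjective (lookup τ) (distinct⇒lookup-injective τ d) i
      in pathFrom-degenerate σ i (degenerate⇒[]≔true-invariant σ i f⁺≡f⁻) _ τ j τⱼ≡i

  ψLin-degenerate-terms : ∀ {m k} (xs : List (Carrier × (Vec Bool (suc k) → Fin m))) →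
    All (λ p → IsDegenerateCube (proj₂ p)) xs → Degenerate-terms (ψLin R xs)
  ψLin-degenerate-terms []             []         = []
  ψLin-degenerate-terms ((r , σ) ∷ xs) (deg ∷ ds) =
    ++⁺ (map⁺ (ψ-degenerate-terms σ deg)) (ψLin-degenerate-terms xs ds)

lemma5p2 : ∀ {c ℓ : Level} (R : CommutativeRing c ℓ) (G : Graph) (k : ℕ) →
    -- (1) ψ kills every degenerate singular n-cube, n = k + 1 ≥ 1
    (∀ (σ : Vec Bool (suc k) → Fin (V G)) →
       IsSingularCube G (suc k) σ → IsDegenerateCube σ → IsZeroInC R (ψ R σ))
    ×
    -- (2) hence the linear extension of ψ kills the submodule spanned by
    --     degenerate cubes, so it descends to C^Cube_n(G)
    (∀ (xs : List (CommutativeRing.Carrier R × (Vec Bool (suc k) → Fin (V G)))) →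
       All (λ p → IsSingularCube G (suc k) (proj₂ p) × IsDegenerateCube (proj₂ p)) xs →
       IsZeroInC R (ψLin R xs))
lemma5p2 R G k =
  (λ σ _ deg → degenerate-terms⇒zero R (ψ R σ) (ψ-degenerate-terms R σ deg)) ,
  (λ xs hyps → degenerate-terms⇒zero R (ψLin R xs)
                 (ψLin-degenerate-terms R xs (All.map proj₂ hyps)))
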